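{- Every $B$-sequent $[\Gamma;\Psi;\Phi;\Delta]$ that is derivable in the $B$-sequent calculus described in the context is valid.
   Context: Language $\mathcal{S}$: formulas built from propositional variables with $\neg$, $\wedge$, $\vee$. Truth values $\mathbf{4}=\{\mathbf{f},\bot,\top,\mathbf{t}\}$ with truth order $\leq_t$: $\mathbf{f}$ least, $\mathbf{t}$ greatest, $\bot,\top$ incomparable in between; $-_t$ swaps $\mathbf{t},\mathbf{f}$ and fixes $\bot,\top$; $\sqcap_t,\sqcup_t$ meet and join. An agent is a map $s:\mathcal{S}\to\mathbf{4}$ with $s(\neg\varphi)=-_ts(\varphi)$, $s(\varphi\wedge\psi)=s(\varphi)\sqcap_ts(\psi)$, $s(\varphi\vee\psi)=s(\varphi)\sqcup_ts(\psi)$. $s$ accepts $\varphi$ iff $s(\varphi)\in\{\top,\mathbf{t}\}$, not-accepts iff $s(\varphi)\in\{\mathbf{f},\bot\}$, rejects iff $s(\varphi)\in\{\mathbf{f},\top\}$, not-rejects iff $s(\varphi)\in\{\bot,\mathbf{t}\}$. A $B$-sequent is a quadruple $[\Gamma;\Psi;\Phi;\Delta]$ of finite sets of formulas; it is valid iff there is no agent that accepts all of $\Gamma$, not-rejects all of $\Psi$, rejects all of $\Phi$ and not-accepts all of $\Delta$ (equivalently, every agent not-accepts some member of $\Gamma$, or not-rejects... i.e. rejects some member of $\Psi$, or not-rejects some member of $\Phi$, or accepts some member of $\Delta$). Below "$\alpha,\Gamma$" means $\{\alpha\}\cup\Gamma$. Rules of the calculus (premises $\Rightarrow$ conclusion):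 Initial: $[\{\alpha\};\emptyset;\emptyset;\{\alpha\}]$ and $[\emptyset;\{\alpha\};\{\alpha\};\emptyset]$. Weakening: from $[\Gamma;\Psi;\Phi;\Delta]$ infer $[\Gamma\cup\Gamma';\Psi\cup\Psi';\Phi\cup\Phi';\Delta\cup\Delta']$. Cut$_t$: from $[\alpha,\Gamma;\Psi;\Phi;\Delta]$ and $[\Gamma;\Psi;\Phi;\Delta,\alpha]$ infer $[\Gamma;\Psi;\Phi;\Delta]$. Cut$_f$: from $[\Gamma;\alpha,\Psi;\Phi;\Delta]$ and $[\Gamma;\Psi;\Phi,\alpha;\Delta]$ infer $[\Gamma;\Psi;\Phi;\Delta]$. Conjunction: from $[\Gamma;\Psi;\Phi;\Delta,\alpha]$ and $[\Gamma;\Psi;\Phi;\Delta,\beta]$ infer $[\Gamma;\Psi;\Phi;\Delta,\alpha\wedge\beta]$; from $[\Gamma;\Psi;\Phi,\alpha;\Delta]$ and $[\Gamma;\Psi;\Phi,\beta;\Delta]$ infer $[\Gamma;\Psi;\Phi,\alpha\wedge\beta;\Delta]$; from $[\alpha,\beta,\Gamma;\Psi;\Phi;\Delta]$ infer $[\alpha\wedge\beta,\Gamma;\Psi;\Phi;\Delta]$; from $[\Gamma;\alpha,\beta,\Psi;\Phi;\Delta]$ infer $[\Gamma;\alpha\wedge\beta,\Psi;\Phi;\Delta]$. Disjunction: from $[\Gamma;\alpha,\Psi;\Phi;\Delta]$ and $[\Gamma;\beta,\Psi;\Phi;\Delta]$ infer $[\Gamma;\alpha\vee\beta,\Psi;\Phi;\Delta]$;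 from $[\alpha,\Gamma;\Psi;\Phi;\Delta]$ and $[\beta,\Gamma;\Psi;\Phi;\Delta]$ infer $[\alpha\vee\beta,\Gamma;\Psi;\Phi;\Delta]$; from $[\Gamma;\Psi;\Phi,\alpha,\beta;\Delta]$ infer $[\Gamma;\Psi;\Phi,\alpha\vee\beta;\Delta]$; from $[\Gamma;\Psi;\Phi;\Delta,\alpha,\beta]$ infer $[\Gamma;\Psi;\Phi;\Delta,\alpha\vee\beta]$. Negation: from $[\Gamma;\Psi;\Phi,\alpha;\Delta]$ infer $[\neg\alpha,\Gamma;\Psi;\Phi;\Delta]$; from $[\Gamma;\Psi;\Phi;\Delta,\alpha]$ infer $[\Gamma;\neg\alpha,\Psi;\Phi;\Delta]$; from $[\alpha,\Gamma;\Psi;\Phi;\Delta]$ infer $[\Gamma;\Psi;\Phi,\neg\alpha;\Delta]$; from $[\Gamma;\alpha,\Psi;\Phi;\Delta]$ infer $[\Gamma;\Psi;\Phi;\Delta,\neg\alpha]$. A $B$-sequent is derivable if it is the root of a finite tree built with these rules. -}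

module Defs where

open import Data.Nat using (ℕ)
open import Data.List using (List; []; _∷_; _++_; [_])
open import Data.List.Membership.Propositional using (_∈_)
open import Data.Product using (_×_; Σ)
open import Relation.Binary.PropositionalEquality using (_≡_)
open import Relation.Nullary using (¬_)

data Fm : Set where
  var : ℕ → Fm
  ¬'_ : Fm → Fm
  _∧'_ : Fm → Fm → Fm
  _∨'_ : Fm → Fm → Fm

data V4 : Set where
  𝐟 ⊥₄ ⊤₄ 𝐭 : V4

neg : V4 → V4
neg 𝐟 = 𝐭
neg 𝐭 = 𝐟
neg ⊥₄ = ⊥₄
neg ⊤₄ = ⊤₄

meet : V4 → V4 → V4
meet 𝐟 y = 𝐟
meet 𝐭 y = y
meet ⊥₄ 𝐟 = 𝐟
meet ⊥₄ ⊥₄ = ⊥₄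
meet ⊥₄ ⊤₄ = 𝐟
meet ⊥₄ 𝐭 = ⊥₄
meet ⊤₄ 𝐟 = 𝐟
meet ⊤₄ ⊥₄ = 𝐟
meet ⊤₄ ⊤₄ = ⊤₄
meet ⊤₄ 𝐭 = ⊤₄

join : V4 → V4 → V4
join 𝐭 y = 𝐭
join 𝐟 y = y
join ⊥₄ 𝐭 = 𝐭
join ⊥₄ ⊥₄ = ⊥₄
join ⊥₄ ⊤₄ = 𝐭
join ⊥₄ 𝐟 = ⊥₄
join ⊤₄ 𝐭 = 𝐭
join ⊤₄ ⊥₄ = 𝐭
join ⊤₄ ⊤₄ = ⊤₄
join ⊤₄ 𝐟 = ⊤₄

record Agent : Set where
  field
    s     : Fm → V4
    s-¬   : ∀ φ → s (¬' φ) ≡ neg (s φ)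
    s-∧   : ∀ φ ψ → s (φ ∧' ψ) ≡ meet (s φ) (s ψ)
    s-∨   : ∀ φ ψ → s (φ ∨' ψ) ≡ join (s φ) (s ψ)
open Agent public

Accepts NotAccepts Rejects NotRejects : Agent → Fm → Set
Accepts a φ = (s a φ ≡ ⊤₄) ⊎' (s a φ ≡ 𝐭)
  where open import Data.Sum renaming (_⊎_ to _⊎'_)
NotAccepts a φ = (s a φ ≡ 𝐟) ⊎' (s a φ ≡ ⊥₄)
  where open import Data.Sum renaming (_⊎_ to _⊎'_)
Rejects a φ = (s a φ ≡ 𝐟) ⊎' (s a φ ≡ ⊤₄)
  where open import Data.Sum renaming (_⊎_ to _⊎'_)
NotRejects a φ = (s a φ ≡ ⊥₄) ⊎' (s a φ ≡ 𝐭)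
  where open import Data.Sum renaming (_⊎_ to _⊎'_)

-- B-sequents [Γ;Ψ;Φ;Δ]; finite sets represented by lists (only membership matters)
record BSeq : Set where
  constructor ⟦_︔_︔_︔_⟧
  field
    Γ Ψ Φ Δ : List Fm

Valid : BSeq → Set
Valid ⟦ Γ ︔ Ψ ︔ Φ ︔ Δ ⟧ =
  ¬ (Σ Agent λ a →
       (∀ φ → φ ∈ Γ → Accepts a φ) ×
       (∀ φ → φ ∈ Ψ → NotRejects a φ) ×
       (∀ φ → φ ∈ Φ → Rejects a φ) ×
       (∀ φ → φ ∈ Δ → NotAccepts a φ))

SameSet : List Fm → List Fm → Set
SameSet A B = (∀ φ → φ ∈ A → φ ∈ B) × (∀ φ → φ ∈ B → φ ∈ A)

-- Derivability in the B-sequent calculus.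
-- "α,Γ" is α ∷ Γ, "Δ,α" is Δ ++ [ α ] (as sets, placement is irrelevant), ∪ is ++.
data ⊢_ : BSeq → Set where
  -- lists stand for finite sets: sequents with the same member sets are identified
  setEq : ∀ {Γ Ψ Φ Δ Γ' Ψ' Φ' Δ'} → SameSet Γ Γ' → SameSet Ψ Ψ' → SameSet Φ Φ' → SameSet Δ Δ' →
          ⊢ ⟦ Γ ︔ Ψ ︔ Φ ︔ Δ ⟧ → ⊢ ⟦ Γ' ︔ Ψ' ︔ Φ' ︔ Δ' ⟧
  init₁ : ∀ α → ⊢ ⟦ [ α ] ︔ [] ︔ [] ︔ [ α ] ⟧
  init₂ : ∀ α → ⊢ ⟦ [] ︔ [ α ] ︔ [ α ] ︔ [] ⟧
  weak  : ∀ {Γ Ψ Φ Δ} Γ' Ψ' Φ' Δ' → ⊢ ⟦ Γ ︔ Ψ ︔ Φ ︔ Δ ⟧ →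
          ⊢ ⟦ Γ ++ Γ' ︔ Ψ ++ Ψ' ︔ Φ ++ Φ' ︔ Δ ++ Δ' ⟧
  cutₜ  : ∀ {Γ Ψ Φ Δ} α → ⊢ ⟦ α ∷ Γ ︔ Ψ ︔ Φ ︔ Δ ⟧ → ⊢ ⟦ Γ ︔ Ψ ︔ Φ ︔ Δ ++ [ α ] ⟧ →
          ⊢ ⟦ Γ ︔ Ψ ︔ Φ ︔ Δ ⟧
  cutf  : ∀ {Γ Ψ Φ Δ} α → ⊢ ⟦ Γ ︔ α ∷ Ψ ︔ Φ ︔ Δ ⟧ → ⊢ ⟦ Γ ︔ Ψ ︔ Φ ++ [ α ] ︔ Δ ⟧ →
          ⊢ ⟦ Γ ︔ Ψ ︔ Φ ︔ Δ ⟧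
  ∧Δ    : ∀ {Γ Ψ Φ Δ} α β → ⊢ ⟦ Γ ︔ Ψ ︔ Φ ︔ Δ ++ [ α ] ⟧ → ⊢ ⟦ Γ ︔ Ψ ︔ Φ ︔ Δ ++ [ β ] ⟧ →
          ⊢ ⟦ Γ ︔ Ψ ︔ Φ ︔ Δ ++ [ α ∧' β ] ⟧
  ∧Φ    : ∀ {Γ Ψ Φ Δ} α β → ⊢ ⟦ Γ ︔ Ψ ︔ Φ ++ [ α ] ︔ Δ ⟧ → ⊢ ⟦ Γ ︔ Ψ ︔ Φ ++ [ β ] ︔ Δ ⟧ →
          ⊢ ⟦ Γ ︔ Ψ ︔ Φ ++ [ α ∧' β ] ︔ Δ ⟧
  ∧Γ    : ∀ {Γ Ψ Φ Δ} α β → ⊢ ⟦ α ∷ β ∷ Γ ︔ Ψ ︔ Φ ︔ Δ ⟧ →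
          ⊢ ⟦ (α ∧' β) ∷ Γ ︔ Ψ ︔ Φ ︔ Δ ⟧
  ∧Ψ    : ∀ {Γ Ψ Φ Δ} α β → ⊢ ⟦ Γ ︔ α ∷ β ∷ Ψ ︔ Φ ︔ Δ ⟧ →
          ⊢ ⟦ Γ ︔ (α ∧' β) ∷ Ψ ︔ Φ ︔ Δ ⟧
  ∨Ψ    : ∀ {Γ Ψ Φ Δ} α β → ⊢ ⟦ Γ ︔ α ∷ Ψ ︔ Φ ︔ Δ ⟧ → ⊢ ⟦ Γ ︔ β ∷ Ψ ︔ Φ ︔ Δ ⟧ →
          ⊢ ⟦ Γ ︔ (α ∨' β) ∷ Ψ ︔ Φ ︔ Δ ⟧
  ∨Γ    : ∀ {Γ Ψ Φ Δ} α β → ⊢ ⟦ α ∷ Γ ︔ Ψ ︔ Φ ︔ Δ ⟧ → ⊢ ⟦ β ∷ Γ ︔ Ψ ︔ Φ ︔ Δ ⟧ →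
          ⊢ ⟦ (α ∨' β) ∷ Γ ︔ Ψ ︔ Φ ︔ Δ ⟧
  ∨Φ    : ∀ {Γ Ψ Φ Δ} α β → ⊢ ⟦ Γ ︔ Ψ ︔ Φ ++ α ∷ β ∷ [] ︔ Δ ⟧ →
          ⊢ ⟦ Γ ︔ Ψ ︔ Φ ++ [ α ∨' β ] ︔ Δ ⟧
  ∨Δ    : ∀ {Γ Ψ Φ Δ} α β → ⊢ ⟦ Γ ︔ Ψ ︔ Φ ︔ Δ ++ α ∷ β ∷ [] ⟧ →
          ⊢ ⟦ Γ ︔ Ψ ︔ Φ ︔ Δ ++ [ α ∨' β ] ⟧
  ¬Γ    : ∀ {Γ Ψ Φ Δ} α → ⊢ ⟦ Γ ︔ Ψ ︔ Φ ++ [ α ] ︔ Δ ⟧ → ⊢ ⟦ (¬' α) ∷ Γ ︔ Ψ ︔ Φ ︔ Δ ⟧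
  ¬Ψ    : ∀ {Γ Ψ Φ Δ} α → ⊢ ⟦ Γ ︔ Ψ ︔ Φ ︔ Δ ++ [ α ] ⟧ → ⊢ ⟦ Γ ︔ (¬' α) ∷ Ψ ︔ Φ ︔ Δ ⟧
  ¬Φ    : ∀ {Γ Ψ Φ Δ} α → ⊢ ⟦ α ∷ Γ ︔ Ψ ︔ Φ ︔ Δ ⟧ → ⊢ ⟦ Γ ︔ Ψ ︔ Φ ++ [ ¬' α ] ︔ Δ ⟧
  ¬Δ    : ∀ {Γ Ψ Φ Δ} α → ⊢ ⟦ Γ ︔ α ∷ Ψ ︔ Φ ︔ Δ ⟧ → ⊢ ⟦ Γ ︔ Ψ ︔ Φ ︔ Δ ++ [ ¬' α ] ⟧

-- The four truth values are the pairs (accepted?, rejected?) of Belnap's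
-- bilattice: 𝐟 = (no, yes), ⊥ = (no, no), ⊤ = (yes, yes), 𝐭 = (yes, no).
-- In these coordinates the truth-order meet is "and" on acceptance and "or" on
-- rejection, the join is dual, and -_t swaps the coordinates. Each of the four
-- positions of a B-sequent fixes one coordinate of its formulas, so every rule
-- becomes a statement about Boolean ∧, ∨ on one coordinate, and a counterexample
-- to the conclusion of a rule restricts to a counterexample to one of its
-- premises.
module Submission where

open import Defs
open import Data.Bool using (Bool; true; false; _∧_; _∨_)
open import Data.Bool.Properties using (∧-conicalˡ; ∧-conicalʳ; ∨-conicalˡ; ∨-conicalʳ; not-¬)
open import Data.List using (List)
open import Data.List.Membership.Propositional using (_∈_)
open import Data.List.Relation.Unary.All as All using (All; []; _∷_)
open import Data.List.Relation.Unary.All.Properties using (anti-mono; ++⁺; ++⁻ˡ; ∷ʳ⁺; ∷ʳ⁻)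
open import Data.Product using (_×_; _,_)
open import Data.Sum using (_⊎_; inj₁; inj₂)
open import Relation.Binary.PropositionalEquality using (_≡_; refl; sym; trans; cong)
open import Relation.Nullary using (¬_)

accepted rejected : V4 → Bool
accepted 𝐟  = false
accepted ⊥₄ = false
accepted ⊤₄ = true
accepted 𝐭  = true
rejected 𝐟  = true
rejected ⊥₄ = false
rejected ⊤₄ = true
rejected 𝐭  = false

accepted-meet : ∀ x y → accepted (meet x y) ≡ accepted x ∧ accepted y
accepted-meet 𝐟  y  = refl
accepted-meet 𝐭  y  = refl
accepted-meet ⊥₄ 𝐟  = refl
accepted-meet ⊥₄ ⊥₄ = refl
accepted-meet ⊥₄ ⊤₄ = refl
accepted-meet ⊥₄ 𝐭  = refl
accepted-meet ⊤₄ 𝐟  = refl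
accepted-meet ⊤₄ ⊥₄ = refl
accepted-meet ⊤₄ ⊤₄ = refl
accepted-meet ⊤₄ 𝐭  = refl

rejected-meet : ∀ x y → rejected (meet x y) ≡ rejected x ∨ rejected y
rejected-meet 𝐟  y  = refl
rejected-meet 𝐭  y  = refl
rejected-meet ⊥₄ 𝐟  = refl
rejected-meet ⊥₄ ⊥₄ = refl
rejected-meet ⊥₄ ⊤₄ = refl
rejected-meet ⊥₄ 𝐭  = refl
rejected-meet ⊤₄ 𝐟  = refl
rejected-meet ⊤₄ ⊥₄ = refl
rejected-meet ⊤₄ ⊤₄ = refl
rejected-meet ⊤₄ 𝐭  = refl

accepted-join : ∀ x y → accepted (join x y) ≡ accepted x ∨ accepted y
accepted-join 𝐟  y  = refl
accepted-join 𝐭  y  = refl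
accepted-join ⊥₄ 𝐟  = refl
accepted-join ⊥₄ ⊥₄ = refl
accepted-join ⊥₄ ⊤₄ = refl
accepted-join ⊥₄ 𝐭  = refl
accepted-join ⊤₄ 𝐟  = refl
accepted-join ⊤₄ ⊥₄ = refl
accepted-join ⊤₄ ⊤₄ = refl
accepted-join ⊤₄ 𝐭  = refl

rejected-join : ∀ x y → rejected (join x y) ≡ rejected x ∧ rejected y
rejected-join 𝐟  y  = refl
rejected-join 𝐭  y  = refl
rejected-join ⊥₄ 𝐟  = refl
rejected-join ⊥₄ ⊥₄ = refl
rejected-join ⊥₄ ⊤₄ = refl
rejected-join ⊥₄ 𝐭  = refl
rejected-join ⊤₄ 𝐟  = refl
rejected-join ⊤₄ ⊥₄ = refl
rejected-join ⊤₄ ⊤₄ = refl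
rejected-join ⊤₄ 𝐭  = refl

accepted-neg : ∀ x → accepted (neg x) ≡ rejected x
accepted-neg 𝐟  = refl
accepted-neg ⊥₄ = refl
accepted-neg ⊤₄ = refl
accepted-neg 𝐭  = refl

rejected-neg : ∀ x → rejected (neg x) ≡ accepted x
rejected-neg 𝐟  = refl
rejected-neg ⊥₄ = refl
rejected-neg ⊤₄ = refl
rejected-neg 𝐭  = refl

∧≡false : ∀ {x y} → x ∧ y ≡ false → x ≡ false ⊎ y ≡ false
∧≡false {false} _ = inj₁ refl
∧≡false {true}  eq = inj₂ eq

∨≡true : ∀ {x y} → x ∨ y ≡ true → x ≡ true ⊎ y ≡ true
∨≡true {true}  _ = inj₁ refl
∨≡true {false} eq = inj₂ eq

∧≡true : ∀ {x y} → x ∧ y ≡ true → x ≡ true × y ≡ true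
∧≡true {x} {y} eq = ∧-conicalˡ x y eq , ∧-conicalʳ x y eq

∨≡false : ∀ {x y} → x ∨ y ≡ false → x ≡ false × y ≡ false
∨≡false {x} {y} eq = ∨-conicalˡ x y eq , ∨-conicalʳ x y eq

Accepts⇒accepted : ∀ {v} → (v ≡ ⊤₄) ⊎ (v ≡ 𝐭) → accepted v ≡ true
Accepts⇒accepted (inj₁ refl) = refl
Accepts⇒accepted (inj₂ refl) = refl

NotAccepts⇒¬accepted : ∀ {v} → (v ≡ 𝐟) ⊎ (v ≡ ⊥₄) → accepted v ≡ false
NotAccepts⇒¬accepted (inj₁ refl) = refl
NotAccepts⇒¬accepted (inj₂ refl) = refl

Rejects⇒rejected : ∀ {v} → (v ≡ 𝐟) ⊎ (v ≡ ⊤₄) → rejected v ≡ true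
Rejects⇒rejected (inj₁ refl) = refl
Rejects⇒rejected (inj₂ refl) = refl

NotRejects⇒¬rejected : ∀ {v} → (v ≡ ⊥₄) ⊎ (v ≡ 𝐭) → rejected v ≡ false
NotRejects⇒¬rejected (inj₁ refl) = refl
NotRejects⇒¬rejected (inj₂ refl) = refl

module _ (a : Agent) where

  accepts? rejects? : Fm → Bool
  accepts? φ = accepted (s a φ)
  rejects? φ = rejected (s a φ)

  accepts?-∧ : ∀ φ ψ → accepts? (φ ∧' ψ) ≡ accepts? φ ∧ accepts? ψ
  accepts?-∧ φ ψ = trans (cong accepted (s-∧ a φ ψ)) (accepted-meet (s a φ) (s a ψ))

  rejects?-∧ : ∀ φ ψ → rejects? (φ ∧' ψ) ≡ rejects? φ ∨ rejects? ψ
  rejects?-∧ φ ψ = trans (cong rejected (s-∧ a φ ψ)) (rejected-meet (s a φ) (s a ψ))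

  accepts?-∨ : ∀ φ ψ → accepts? (φ ∨' ψ) ≡ accepts? φ ∨ accepts? ψ
  accepts?-∨ φ ψ = trans (cong accepted (s-∨ a φ ψ)) (accepted-join (s a φ) (s a ψ))

  rejects?-∨ : ∀ φ ψ → rejects? (φ ∨' ψ) ≡ rejects? φ ∧ rejects? ψ
  rejects?-∨ φ ψ = trans (cong rejected (s-∨ a φ ψ)) (rejected-join (s a φ) (s a ψ))

  accepts?-¬ : ∀ φ → accepts? (¬' φ) ≡ rejects? φ
  accepts?-¬ φ = trans (cong accepted (s-¬ a φ)) (accepted-neg (s a φ))

  rejects?-¬ : ∀ φ → rejects? (¬' φ) ≡ accepts? φ
  rejects?-¬ φ = trans (cong rejected (s-¬ a φ)) (rejected-neg (s a φ))

  Counterexample : BSeq → Set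
  Counterexample ⟦ Γ ︔ Ψ ︔ Φ ︔ Δ ⟧ =
    All (λ φ → accepts? φ ≡ true) Γ × All (λ φ → rejects? φ ≡ false) Ψ ×
    All (λ φ → rejects? φ ≡ true) Φ × All (λ φ → accepts? φ ≡ false) Δ

  derivable⇒noCounterexample : ∀ {S} → ⊢ S → ¬ Counterexample S
  derivable⇒noCounterexample (setEq (Γ⊆Γ' , _) (Ψ⊆Ψ' , _) (Φ⊆Φ' , _) (Δ⊆Δ' , _) d) (g , p , f , n) =
    derivable⇒noCounterexample d
      (anti-mono (Γ⊆Γ' _) g , anti-mono (Ψ⊆Ψ' _) p , anti-mono (Φ⊆Φ' _) f , anti-mono (Δ⊆Δ' _) n)
  derivable⇒noCounterexample (init₁ α) (g ∷ [] , _ , _ , n ∷ []) = not-¬ g n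
  derivable⇒noCounterexample (init₂ α) (_ , p ∷ [] , f ∷ [] , _) = not-¬ f p
  derivable⇒noCounterexample (weak {Γ} {Ψ} {Φ} {Δ} _ _ _ _ d) (g , p , f , n) =
    derivable⇒noCounterexample d (++⁻ˡ Γ g , ++⁻ˡ Ψ p , ++⁻ˡ Φ f , ++⁻ˡ Δ n)
  derivable⇒noCounterexample (cutₜ α d₁ d₂) (g , p , f , n) with accepts? α in eq
  ... | true  = derivable⇒noCounterexample d₁ (eq ∷ g , p , f , n)
  ... | false = derivable⇒noCounterexample d₂ (g , p , f , ∷ʳ⁺ n eq)
  derivable⇒noCounterexample (cutf α d₁ d₂) (g , p , f , n) with rejects? α in eq
  ... | false = derivable⇒noCounterexample d₁ (g , eq ∷ p , f , n)
  ... | true  = derivable⇒noCounterexample d₂ (g , p , ∷ʳ⁺ f eq , n)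
  derivable⇒noCounterexample (∧Δ α β d₁ d₂) (g , p , f , n) with ∷ʳ⁻ n
  ... | n' , h with ∧≡false (trans (sym (accepts?-∧ α β)) h)
  ...   | inj₁ hα = derivable⇒noCounterexample d₁ (g , p , f , ∷ʳ⁺ n' hα)
  ...   | inj₂ hβ = derivable⇒noCounterexample d₂ (g , p , f , ∷ʳ⁺ n' hβ)
  derivable⇒noCounterexample (∧Φ α β d₁ d₂) (g , p , f , n) with ∷ʳ⁻ f
  ... | f' , h with ∨≡true (trans (sym (rejects?-∧ α β)) h)
  ...   | inj₁ hα = derivable⇒noCounterexample d₁ (g , p , ∷ʳ⁺ f' hα , n)
  ...   | inj₂ hβ = derivable⇒noCounterexample d₂ (g , p , ∷ʳ⁺ f' hβ , n)
  derivable⇒noCounterexample (∧Γ α β d) (h ∷ g , p , f , n) =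
    let hα , hβ = ∧≡true (trans (sym (accepts?-∧ α β)) h)
    in derivable⇒noCounterexample d (hα ∷ hβ ∷ g , p , f , n)
  derivable⇒noCounterexample (∧Ψ α β d) (g , h ∷ p , f , n) =
    let hα , hβ = ∨≡false (trans (sym (rejects?-∧ α β)) h)
    in derivable⇒noCounterexample d (g , hα ∷ hβ ∷ p , f , n)
  derivable⇒noCounterexample (∨Ψ α β d₁ d₂) (g , h ∷ p , f , n) with ∧≡false (trans (sym (rejects?-∨ α β)) h)
  ... | inj₁ hα = derivable⇒noCounterexample d₁ (g , hα ∷ p , f , n)
  ... | inj₂ hβ = derivable⇒noCounterexample d₂ (g , hβ ∷ p , f , n)
  derivable⇒noCounterexample (∨Γ α β d₁ d₂) (h ∷ g , p , f , n) with ∨≡true (trans (sym (accepts?-∨ α β)) h)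
  ... | inj₁ hα = derivable⇒noCounterexample d₁ (hα ∷ g , p , f , n)
  ... | inj₂ hβ = derivable⇒noCounterexample d₂ (hβ ∷ g , p , f , n)
  derivable⇒noCounterexample (∨Φ α β d) (g , p , f , n) =
    let f' , h = ∷ʳ⁻ f
        hα , hβ = ∧≡true (trans (sym (rejects?-∨ α β)) h)
    in derivable⇒noCounterexample d (g , p , ++⁺ f' (hα ∷ hβ ∷ []) , n)
  derivable⇒noCounterexample (∨Δ α β d) (g , p , f , n) =
    let n' , h = ∷ʳ⁻ n
        hα , hβ = ∨≡false (trans (sym (accepts?-∨ α β)) h)
    in derivable⇒noCounterexample d (g , p , f , ++⁺ n' (hα ∷ hβ ∷ []))
  derivable⇒noCounterexample (¬Γ α d) (h ∷ g , p , f , n) =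
    derivable⇒noCounterexample d (g , p , ∷ʳ⁺ f (trans (sym (accepts?-¬ α)) h) , n)
  derivable⇒noCounterexample (¬Ψ α d) (g , h ∷ p , f , n) =
    derivable⇒noCounterexample d (g , p , f , ∷ʳ⁺ n (trans (sym (rejects?-¬ α)) h))
  derivable⇒noCounterexample (¬Φ α d) (g , p , f , n) =
    let f' , h = ∷ʳ⁻ f
    in derivable⇒noCounterexample d (trans (sym (rejects?-¬ α)) h ∷ g , p , f' , n)
  derivable⇒noCounterexample (¬Δ α d) (g , p , f , n) =
    let n' , h = ∷ʳ⁻ n
    in derivable⇒noCounterexample d (g , trans (sym (accepts?-¬ α)) h ∷ p , f , n')

allOf : ∀ {P Q : Fm → Set} {L : List Fm} → (∀ {φ} → P φ → Q φ) → (∀ φ → φ ∈ L → P φ) → All Q L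
allOf P⇒Q h = All.tabulate (λ {φ} φ∈L → P⇒Q (h φ φ∈L))

mainTheorem3 : (S : BSeq) → ⊢ S → Valid S
mainTheorem3 ⟦ Γ ︔ Ψ ︔ Φ ︔ Δ ⟧ d (a , g , p , f , n) =
  derivable⇒noCounterexample a d
    ( allOf Accepts⇒accepted g , allOf NotRejects⇒¬rejected p
    , allOf Rejects⇒rejected f , allOf NotAccepts⇒¬accepted n )
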